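{- Let $A(x)=\frac{x}{1+x}$, $B(x)=\frac{x}{1+x^2}$, $B_0(x)=x$, $B_j(x)=B(B_{j-1}(x))$ for $j\ge 1$, and $A_j(x)=A(B_j(x))$. The functional equation \[T(x)=1+\frac{x}{1+x}\,T\!\left(\frac{x}{1+x^2}\right)\] for a formal power series $T(x)$ (in particular satisfied by the cluster generating function $T(x)$ of the consecutive pattern $1423$ described in the context) has the solution \[T(x)=1+\sum_{n=0}^{\infty}\prod_{j=0}^{n}A_j(x)=1+\sum_{n=0}^{\infty}\prod_{j=0}^{n}\frac{B_j(x)}{1+B_j(x)},\] the sum converging in the sense of formal power series.
   Context: For a consecutive pattern $\sigma$ of length $m$, a $k$-cluster of length $n\ge m$ is a permutation $\pi$ of $\{1,\dots,n\}$ such that $\pi$ contains exactly $k$ occurrences of $\sigma$ as a consecutive pattern (i.e. as contiguous entries in the same relative order as $\sigma$), every entry of $\pi$ belongs to at least one such occurrence, and any two successive occurrences overlap in at least one entry. Let $s_{n,k}$ be the number of $k$-clusters of length $n$, with the conventions $s_{1,0}=1$ and $s_{n,k}=0$ for all other $n<m$. Put $t_n=\sum_k(-1)^k s_{n,k}$ and $T(x)=1+\sum_{n\ge1}t_nx^n$ (an ordinary generating function). For $\sigma=1423$ this $T$ satisfies the displayed functional equation. -}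

module Defs where

open import Data.Nat using (ℕ; zero; suc; _∸_; _≤_)
open import Data.Integer using (ℤ; 0ℤ; 1ℤ; _+_; _*_; -_)
open import Data.Product using (Σ; ∃; _×_)
open import Relation.Binary.PropositionalEquality using (_≡_)

-- Formal power series with integer coefficients: n ↦ [x^n].
Series : Set
Series = ℕ → ℤ

_≈ₛ_ : Series → Series → Set
f ≈ₛ g = ∀ n → f n ≡ g n

sumTo : ℕ → (ℕ → ℤ) → ℤ
sumTo zero f = f 0
sumTo (suc n) f = sumTo n f + f (suc n)

zeroₛ : Series
zeroₛ _ = 0ℤ

oneₛ : Series
oneₛ zero = 1ℤ
oneₛ (suc _) = 0ℤ

Xₛ : Series
Xₛ 1 = 1ℤ
Xₛ _ = 0ℤ

_+ₛ_ : Series → Series → Series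
(f +ₛ g) n = f n + g n

negₛ : Series → Series
negₛ f n = - f n

_*ₛ_ : Series → Series → Series
(f *ₛ g) n = sumTo n (λ i → f i * g (n ∸ i))

powₛ : Series → ℕ → Series
powₛ g zero = oneₛ
powₛ g (suc k) = g *ₛ powₛ g k

-- Composition f(g(x)); meaningful (and used only) when g has zero constant term,
-- in which case [x^n] f(g) = Σ_{k=0}^{n} f_k [x^n] g^k.
compₛ : Series → Series → Series
compₛ f g n = sumTo n (λ k → f k * powₛ g k n)

-- 1/(1+h) = Σ_k (-h)^k, for h with zero constant term.
inv1p : Series → Series
inv1p h n = sumTo n (λ k → powₛ (negₛ h) k n)

Aop : Series → Series
Aop y = y *ₛ inv1p y

Bop : Series → Series
Bop y = y *ₛ inv1p (y *ₛ y)

Aₛ : Series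
Aₛ = Aop Xₛ

Bₛ : Series
Bₛ = Bop Xₛ

Bj : ℕ → Series
Bj zero = Xₛ
Bj (suc j) = Bop (Bj j)

Aj : ℕ → Series
Aj j = Aop (Bj j)

prodA : ℕ → Series
prodA zero = Aj 0
prodA (suc n) = prodA n *ₛ Aj (suc n)

partialSum : ℕ → Series
partialSum N m = sumTo N (λ n → prodA n m)

ConvergesTo : (ℕ → Series) → Series → Set
ConvergesTo s U = ∀ m → ∃ λ N → ∀ N' → N ≤ N' → s N' m ≡ U m

SolvesFE : Series → Set
SolvesFE T = T ≈ₛ (oneₛ +ₛ (Aₛ *ₛ compₛ T Bₛ))

-- Convergence: ∏_{j≤n} A_j has order ≥ n+1, so the m-th coefficient of P_N
-- is frozen once N ≥ m.  The functional equation is the limit of the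
-- recursion P_{N+1} = A · ((1 + P_N) ∘ B), which follows from
-- A_j ∘ B = A_{j+1}.  That identity in turn rests on composition with a
-- series of zero constant term being a ring homomorphism that commutes with
-- y ↦ 1/(1+y).  Uniqueness, as well as these homomorphism properties, come
-- from one principle: a map on series whose n-th output coefficient only
-- depends on input coefficients below n has at most one fixed point.
module Submission where

open import Defs
open import Level using (0ℓ)
open import Data.Nat as N using (ℕ; zero; suc; _∸_; _≤_; _<_; _≤′_; ≤′-refl; ≤′-step; z≤n; s≤s)
import Data.Nat.Properties as NP
open import Data.Nat.Induction using (<-rec)
open import Data.Integer using (ℤ; 0ℤ; 1ℤ; _+_; _*_; -_)
import Data.Integer.Properties as ZP
open import Data.Integer.Tactic.RingSolver using (solve-∀)
open import Data.Unit using (⊤; tt)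
open import Data.Product using (Σ; _×_; _,_)
open import Data.Empty using (⊥-elim)
open import Relation.Nullary using (yes; no)
open import Relation.Binary.Bundles using (Setoid)
import Relation.Binary.Reasoning.Setoid as SetoidReasoning
open import Relation.Binary.PropositionalEquality

sumTo-cong : ∀ n {F G : ℕ → ℤ} → (∀ k → k ≤ n → F k ≡ G k) → sumTo n F ≡ sumTo n G
sumTo-cong zero    e = e 0 z≤n
sumTo-cong (suc n) e = cong₂ _+_ (sumTo-cong n (λ k k≤n → e k (NP.m≤n⇒m≤1+n k≤n))) (e (suc n) NP.≤-refl)

sumTo-+ : ∀ n (F G : ℕ → ℤ) → sumTo n (λ k → F k + G k) ≡ sumTo n F + sumTo n G
sumTo-+ zero    F G = refl
sumTo-+ (suc n) F G rewrite sumTo-+ n F G = interchange (sumTo n F) (sumTo n G) (F (suc n)) (G (suc n))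
  where
  interchange : ∀ (a b c d : ℤ) → a + b + (c + d) ≡ a + c + (b + d)
  interchange = solve-∀

sumTo-*l : ∀ n (a : ℤ) (F : ℕ → ℤ) → sumTo n (λ k → a * F k) ≡ a * sumTo n F
sumTo-*l zero    a F = refl
sumTo-*l (suc n) a F rewrite sumTo-*l n a F = sym (ZP.*-distribˡ-+ a (sumTo n F) (F (suc n)))

sumTo-neg : ∀ n (F : ℕ → ℤ) → sumTo n (λ k → - F k) ≡ - sumTo n F
sumTo-neg zero    F = refl
sumTo-neg (suc n) F rewrite sumTo-neg n F = sym (ZP.neg-distrib-+ (sumTo n F) (F (suc n)))

sumTo-shift : ∀ n (F : ℕ → ℤ) → sumTo (suc n) F ≡ F 0 + sumTo n (λ k → F (suc k))
sumTo-shift zero    F = refl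
sumTo-shift (suc n) F rewrite sumTo-shift n F = ZP.+-assoc (F 0) _ _

sumTo-ext : ∀ n m (F : ℕ → ℤ) → (∀ k → n < k → F k ≡ 0ℤ) → n ≤ m → sumTo m F ≡ sumTo n F
sumTo-ext n m F vanish n≤m = extend (NP.≤⇒≤′ n≤m)
  where
  extend : ∀ {l} → n ≤′ l → sumTo l F ≡ sumTo n F
  extend ≤′-refl           = refl
  extend (≤′-step {l} n≤′l) = begin
    sumTo l F + F (suc l)  ≡⟨ cong₂ _+_ (extend n≤′l) (vanish (suc l) (s≤s (NP.≤′⇒≤ n≤′l))) ⟩
    sumTo n F + 0ℤ         ≡⟨ ZP.+-identityʳ (sumTo n F) ⟩
    sumTo n F              ∎
    where open ≡-Reasoning

-- Antidiagonal sums  conv n F = Σ_{i+j=n} F i j.  The recursion peels off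
-- i = 0 and shifts i, so that reindexing arguments become inductions.

conv : ℕ → (ℕ → ℕ → ℤ) → ℤ
conv zero    F = F 0 0
conv (suc n) F = F 0 (suc n) + conv n (λ i j → F (suc i) j)

sum≡conv : ∀ n (F : ℕ → ℕ → ℤ) → sumTo n (λ i → F i (n ∸ i)) ≡ conv n F
sum≡conv zero    F = refl
sum≡conv (suc n) F = trans (sumTo-shift n (λ i → F i (suc n ∸ i)))
                           (cong (F 0 (suc n) +_) (sum≡conv n (λ i j → F (suc i) j)))

mul≡conv : ∀ (f g : Series) n → (f *ₛ g) n ≡ conv n (λ i j → f i * g j)
mul≡conv f g n = sum≡conv n (λ i j → f i * g j)

conv-cong : ∀ n {F G : ℕ → ℕ → ℤ} → (∀ i j → i N.+ j ≡ n → F i j ≡ G i j) → conv n F ≡ conv n G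
conv-cong zero    e = e 0 0 refl
conv-cong (suc n) e = cong₂ _+_ (e 0 (suc n) refl) (conv-cong n (λ i j i+j≡n → e (suc i) j (cong suc i+j≡n)))

conv-0 : ∀ n (F : ℕ → ℕ → ℤ) → (∀ i j → i N.+ j ≡ n → F i j ≡ 0ℤ) → conv n F ≡ 0ℤ
conv-0 zero    F e = e 0 0 refl
conv-0 (suc n) F e = cong₂ _+_ (e 0 (suc n) refl) (conv-0 n _ (λ i j i+j≡n → e (suc i) j (cong suc i+j≡n)))

conv-+ : ∀ n (F G : ℕ → ℕ → ℤ) → conv n (λ i j → F i j + G i j) ≡ conv n F + conv n G
conv-+ zero    F G = refl
conv-+ (suc n) F G rewrite conv-+ n (λ i j → F (suc i) j) (λ i j → G (suc i) j) =
  interchange (F 0 (suc n)) (G 0 (suc n)) (conv n (λ i j → F (suc i) j)) (conv n (λ i j → G (suc i) j))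
  where
  interchange : ∀ (a b c d : ℤ) → a + b + (c + d) ≡ a + c + (b + d)
  interchange = solve-∀

conv-*l : ∀ n (a : ℤ) (F : ℕ → ℕ → ℤ) → conv n (λ i j → a * F i j) ≡ a * conv n F
conv-*l zero    a F = refl
conv-*l (suc n) a F rewrite conv-*l n a (λ i j → F (suc i) j) =
  sym (ZP.*-distribˡ-+ a (F 0 (suc n)) (conv n (λ i j → F (suc i) j)))

conv-*r : ∀ n (a : ℤ) (F : ℕ → ℕ → ℤ) → conv n (λ i j → F i j * a) ≡ conv n F * a
conv-*r n a F = trans (conv-cong n (λ i j _ → ZP.*-comm (F i j) a)) (trans (conv-*l n a F) (ZP.*-comm a _))

conv-sumTo : ∀ n m (F : ℕ → ℕ → ℕ → ℤ) →
  conv n (λ i j → sumTo m (λ k → F k i j)) ≡ sumTo m (λ k → conv n (F k))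
conv-sumTo n zero    F = refl
conv-sumTo n (suc m) F rewrite conv-+ n (λ i j → sumTo m (λ k → F k i j)) (F (suc m)) | conv-sumTo n m F = refl

conv-last : ∀ n (F : ℕ → ℕ → ℤ) → conv (suc n) F ≡ conv n (λ i j → F i (suc j)) + F (suc n) 0
conv-last zero    F = refl
conv-last (suc n) F rewrite conv-last n (λ i j → F (suc i) j) =
  sym (ZP.+-assoc (F 0 (suc (suc n))) (conv n (λ i j → F (suc i) (suc j))) (F (suc (suc n)) 0))

conv-swap : ∀ n (F : ℕ → ℕ → ℤ) → conv n F ≡ conv n (λ i j → F j i)
conv-swap zero    F = refl
conv-swap (suc n) F rewrite conv-last n (λ i j → F j i) | conv-swap n (λ i j → F (suc i) j) =
  ZP.+-comm (F 0 (suc n)) (conv n (λ i j → F (suc j) i))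

conv-assoc : ∀ n (G : ℕ → ℕ → ℕ → ℤ) →
  conv n (λ i j → conv i (λ a b → G a b j)) ≡ conv n (λ a k → conv k (λ b j → G a b j))
conv-assoc zero    G = refl
conv-assoc (suc n) G
  rewrite conv-+ n (λ i j → G 0 (suc i) j) (λ i j → conv i (λ a b → G (suc a) b j))
        | conv-assoc n (λ a b j → G (suc a) b j) =
  sym (ZP.+-assoc (G 0 0 (suc n)) (conv n (λ i j → G 0 (suc i) j))
                  (conv n (λ a k → conv k (λ b j → G (suc a) b j))))

-- The ring of formal power series.  Coefficientwise equality is wrapped in a
-- record so that the compared series can be inferred from a proof of it.

infix 4 _≈_
record _≈_ (f g : Series) : Set where
  constructor mk≈
  field at : ∀ n → f n ≡ g n
open _≈_ public

≈-refl : ∀ {f} → f ≈ f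
≈-refl = mk≈ λ n → refl

≈-sym : ∀ {f g} → f ≈ g → g ≈ f
≈-sym e = mk≈ λ n → sym (at e n)

≈-trans : ∀ {f g h} → f ≈ g → g ≈ h → f ≈ h
≈-trans e e′ = mk≈ λ n → trans (at e n) (at e′ n)

≈-setoid : Setoid 0ℓ 0ℓ
≈-setoid = record
  { Carrier       = Series
  ; _≈_           = _≈_
  ; isEquivalence = record { refl = ≈-refl ; sym = ≈-sym ; trans = ≈-trans }
  }

module ≈-Reasoning = SetoidReasoning ≈-setoid

scal : ℤ → Series → Series
scal c f n = c * f n

shift : Series → Series
shift f n = f (suc n)

+-cong : ∀ {f f′ g g′} → f ≈ f′ → g ≈ g′ → (f +ₛ g) ≈ (f′ +ₛ g′)
+-cong e e′ = mk≈ λ n → cong₂ _+_ (at e n) (at e′ n)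

*-cong : ∀ {f f′ g g′} → f ≈ f′ → g ≈ g′ → (f *ₛ g) ≈ (f′ *ₛ g′)
*-cong e e′ = mk≈ λ n → sumTo-cong n (λ i _ → cong₂ _*_ (at e i) (at e′ (n ∸ i)))

-- One-sided versions, with the fixed factor explicit (it cannot be inferred
-- from a composite series).
+-congˡ : ∀ f {g g′} → g ≈ g′ → (f +ₛ g) ≈ (f +ₛ g′)
+-congˡ f = +-cong (≈-refl {f})

+-congʳ : ∀ {f f′} g → f ≈ f′ → (f +ₛ g) ≈ (f′ +ₛ g)
+-congʳ g e = +-cong e (≈-refl {g})

*-congˡ : ∀ f {g g′} → g ≈ g′ → (f *ₛ g) ≈ (f *ₛ g′)
*-congˡ f = *-cong (≈-refl {f})

*-congʳ : ∀ {f f′} g → f ≈ f′ → (f *ₛ g) ≈ (f′ *ₛ g)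
*-congʳ g e = *-cong e (≈-refl {g})

scal-cong : ∀ c {f f′} → f ≈ f′ → scal c f ≈ scal c f′
scal-cong c e = mk≈ λ n → cong (c *_) (at e n)

neg-cong : ∀ {f f′} → f ≈ f′ → negₛ f ≈ negₛ f′
neg-cong e = mk≈ λ n → cong -_ (at e n)

pow-cong : ∀ {h h′} → h ≈ h′ → ∀ k → powₛ h k ≈ powₛ h′ k
pow-cong e zero    = ≈-refl
pow-cong e (suc k) = *-cong e (pow-cong e k)

*-assoc : ∀ f g h → ((f *ₛ g) *ₛ h) ≈ (f *ₛ (g *ₛ h))
*-assoc f g h = mk≈ λ n → begin
  ((f *ₛ g) *ₛ h) n                                   ≡⟨ mul≡conv (f *ₛ g) h n ⟩
  conv n (λ i j → (f *ₛ g) i * h j)                   ≡⟨ conv-cong n (λ i j _ → expandˡ i j) ⟩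
  conv n (λ i j → conv i (λ a b → f a * g b * h j))   ≡⟨ conv-assoc n (λ a b j → f a * g b * h j) ⟩
  conv n (λ a k → conv k (λ b j → f a * g b * h j))   ≡⟨ conv-cong n (λ a k _ → collectʳ a k) ⟩
  conv n (λ a k → f a * (g *ₛ h) k)                   ≡⟨ mul≡conv f (g *ₛ h) n ⟨
  (f *ₛ (g *ₛ h)) n                                   ∎
  where
  open ≡-Reasoning
  expandˡ : ∀ i j → (f *ₛ g) i * h j ≡ conv i (λ a b → f a * g b * h j)
  expandˡ i j = trans (cong (_* h j) (mul≡conv f g i)) (sym (conv-*r i (h j) (λ a b → f a * g b)))
  collectʳ : ∀ a k → conv k (λ b j → f a * g b * h j) ≡ f a * (g *ₛ h) k
  collectʳ a k = begin
    conv k (λ b j → f a * g b * h j)    ≡⟨ conv-cong k (λ b j _ → ZP.*-assoc (f a) (g b) (h j)) ⟩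
    conv k (λ b j → f a * (g b * h j))  ≡⟨ conv-*l k (f a) (λ b j → g b * h j) ⟩
    f a * conv k (λ b j → g b * h j)    ≡⟨ cong (f a *_) (mul≡conv g h k) ⟨
    f a * (g *ₛ h) k                    ∎

*-distribˡ : ∀ f g h → (f *ₛ (g +ₛ h)) ≈ ((f *ₛ g) +ₛ (f *ₛ h))
*-distribˡ f g h = mk≈ λ n →
  trans (sumTo-cong n (λ i _ → ZP.*-distribˡ-+ (f i) (g (n ∸ i)) (h (n ∸ i)))) (sumTo-+ n _ _)

*-distribʳ : ∀ f g h → ((f +ₛ g) *ₛ h) ≈ ((f *ₛ h) +ₛ (g *ₛ h))
*-distribʳ f g h = mk≈ λ n →
  trans (sumTo-cong n (λ i _ → ZP.*-distribʳ-+ (h (n ∸ i)) (f i) (g i))) (sumTo-+ n _ _)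

*-comm : ∀ f g → (f *ₛ g) ≈ (g *ₛ f)
*-comm f g = mk≈ λ n → begin
  (f *ₛ g) n                   ≡⟨ mul≡conv f g n ⟩
  conv n (λ i j → f i * g j)   ≡⟨ conv-swap n _ ⟩
  conv n (λ i j → f j * g i)   ≡⟨ conv-cong n (λ i j _ → ZP.*-comm (f j) (g i)) ⟩
  conv n (λ i j → g i * f j)   ≡⟨ mul≡conv g f n ⟨
  (g *ₛ f) n                   ∎
  where open ≡-Reasoning

one-* : ∀ f → (oneₛ *ₛ f) ≈ f
one-* f = mk≈ coefficient
  where
  coefficient : ∀ n → (oneₛ *ₛ f) n ≡ f n
  coefficient zero    = ZP.*-identityˡ (f 0)
  coefficient (suc n) = begin
    (oneₛ *ₛ f) (suc n)                                      ≡⟨ mul≡conv oneₛ f (suc n) ⟩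
    1ℤ * f (suc n) + conv n (λ i j → oneₛ (suc i) * f j)    ≡⟨ cong₂ _+_ (ZP.*-identityˡ (f (suc n)))
                                                                         (conv-0 n _ (λ i j _ → ZP.*-zeroˡ (f j))) ⟩
    f (suc n) + 0ℤ                                           ≡⟨ ZP.+-identityʳ (f (suc n)) ⟩
    f (suc n)                                                ∎
    where open ≡-Reasoning

*-one : ∀ f → (f *ₛ oneₛ) ≈ f
*-one f = ≈-trans (*-comm f oneₛ) (one-* f)

scal-* : ∀ c f g → (scal c f *ₛ g) ≈ scal c (f *ₛ g)
scal-* c f g = mk≈ λ n → trans (sumTo-cong n (λ i _ → ZP.*-assoc c (f i) (g (n ∸ i)))) (sumTo-*l n c _)

*-scal : ∀ c f g → (f *ₛ scal c g) ≈ scal c (f *ₛ g)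
*-scal c f g = ≈-trans (*-comm f (scal c g)) (≈-trans (scal-* c g f) (scal-cong c (*-comm g f)))

shift-* : ∀ f g → shift (f *ₛ g) ≈ (scal (f 0) (shift g) +ₛ (shift f *ₛ g))
shift-* f g = mk≈ λ n → trans (mul≡conv f g (suc n)) (cong (f 0 * g (suc n) +_) (sym (mul≡conv (shift f) g n)))

OrderAtLeast : ℕ → Series → Set
OrderAtLeast a f = ∀ m → m < a → f m ≡ 0ℤ

order-one : ∀ h → h 0 ≡ 0ℤ → OrderAtLeast 1 h
order-one h h0 zero    _         = h0
order-one h h0 (suc m) (s≤s ())

order-* : ∀ a b f g → OrderAtLeast a f → OrderAtLeast b g → OrderAtLeast (a N.+ b) (f *ₛ g)
order-* a b f g ordf ordg m m<a+b = trans (mul≡conv f g m) (conv-0 m _ termVanishes)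
  where
  termVanishes : ∀ i j → i N.+ j ≡ m → f i * g j ≡ 0ℤ
  termVanishes i j i+j≡m with i N.<? a | j N.<? b
  ... | yes i<a | _       rewrite ordf i i<a = ZP.*-zeroˡ (g j)
  ... | no  _   | yes j<b rewrite ordg j j<b = ZP.*-zeroʳ (f i)
  ... | no  i≮a | no  j≮b = ⊥-elim (NP.<⇒≱ m<a+b
        (subst (a N.+ b ≤_) i+j≡m (NP.+-mono-≤ (NP.≮⇒≥ i≮a) (NP.≮⇒≥ j≮b))))

order-pow : ∀ h → h 0 ≡ 0ℤ → ∀ k → OrderAtLeast k (powₛ h k)
order-pow h h0 zero    m ()
order-pow h h0 (suc k) = order-* 1 k h (powₛ h k) (order-one h h0) (order-pow h h0 k)

mul0 : ∀ f g → f 0 ≡ 0ℤ → (f *ₛ g) 0 ≡ 0ℤ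
mul0 f g f0 = cong (_* g 0) f0

mul-localʳ : ∀ f {g g′} n → (∀ j → j ≤ n → g j ≡ g′ j) → (f *ₛ g) n ≡ (f *ₛ g′) n
mul-localʳ f n e = sumTo-cong n (λ i _ → cong (f i *_) (e (n ∸ i) (NP.m∸n≤m n i)))

mul-local-strict : ∀ f {g g′} n → f 0 ≡ 0ℤ → (∀ j → j < n → g j ≡ g′ j) → (f *ₛ g) n ≡ (f *ₛ g′) n
mul-local-strict f {g} {g′} n f0 e = trans (mul≡conv f g n) (trans (conv-cong n sameTerm) (sym (mul≡conv f g′ n)))
  where
  sameTerm : ∀ i j → i N.+ j ≡ n → f i * g j ≡ f i * g′ j
  sameTerm zero    j _ rewrite f0 = trans (ZP.*-zeroˡ (g j)) (sym (ZP.*-zeroˡ (g′ j)))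
  sameTerm (suc i) j i+j≡n = cong (f (suc i) *_) (e j (subst (suc j ≤_) i+j≡n (s≤s (NP.m≤n+m j i))))

Contractive : {I : Set} → ((I → Series) → I → Series) → Set
Contractive {I} Φ = ∀ n (F G : I → Series) → (∀ i m → m < n → F i m ≡ G i m) → ∀ i → Φ F i n ≡ Φ G i n

fixpoint-unique : {I : Set} (Φ : (I → Series) → I → Series) → Contractive Φ →
  {F G : I → Series} → (∀ i → F i ≈ Φ F i) → (∀ i → G i ≈ Φ G i) → ∀ i → F i ≈ G i
fixpoint-unique Φ contractive {F} {G} hF hG i = mk≈ λ n → <-rec Agree step n i
  where
  Agree : ℕ → Set
  Agree n = ∀ i → F i n ≡ G i n
  step : ∀ n → (∀ {m} → m < n → Agree m) → Agree n
  step n below i = begin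
    F i n    ≡⟨ at (hF i) n ⟩
    Φ F i n  ≡⟨ contractive n F G (λ i′ m m<n → below m<n i′) i ⟩
    Φ G i n  ≡⟨ at (hG i) n ⟨
    G i n    ∎
    where open ≡-Reasoning

fixpoint-unique₁ : (Φ : Series → Series) →
  (∀ n f g → (∀ m → m < n → f m ≡ g m) → Φ f n ≡ Φ g n) →
  {f g : Series} → f ≈ Φ f → g ≈ Φ g → f ≈ g
fixpoint-unique₁ Φ contractive hf hg =
  fixpoint-unique {⊤} (λ F _ → Φ (F tt)) (λ n F G agree _ → contractive n (F tt) (G tt) (agree tt))
                  (λ _ → hf) (λ _ → hg) tt

shift-recursion-unique : (k : Series) → k 0 ≡ 0ℤ → (base F G : Series → Series) →
  (∀ f → F f ≈ (base f +ₛ (k *ₛ F (shift f)))) →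
  (∀ f → G f ≈ (base f +ₛ (k *ₛ G (shift f)))) → ∀ f → F f ≈ G f
shift-recursion-unique k k0 base F G = fixpoint-unique Φ contractive
  where
  Φ : (Series → Series) → Series → Series
  Φ H f = base f +ₛ (k *ₛ H (shift f))
  contractive : Contractive Φ
  contractive n H H′ agree f = cong (base f n +_) (mul-local-strict k n k0 (λ j j<n → agree (shift f) j j<n))

comp-local : ∀ {f f′} h n → (∀ k → k ≤ n → f k ≡ f′ k) → compₛ f h n ≡ compₛ f′ h n
comp-local h n e = sumTo-cong n (λ k k≤n → cong (_* powₛ h k n) (e k k≤n))

comp-cong₁ : ∀ {f f′} h → f ≈ f′ → compₛ f h ≈ compₛ f′ h
comp-cong₁ h e = mk≈ λ n → comp-local h n (λ k _ → at e k)

comp0 : ∀ f h → f 0 ≡ 0ℤ → compₛ f h 0 ≡ 0ℤ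
comp0 f h f0 = cong (_* 1ℤ) f0

comp-+ : ∀ f g h → compₛ (f +ₛ g) h ≈ (compₛ f h +ₛ compₛ g h)
comp-+ f g h = mk≈ λ n → trans (sumTo-cong n (λ k _ → ZP.*-distribʳ-+ (powₛ h k n) (f k) (g k))) (sumTo-+ n _ _)

comp-scal : ∀ c f h → compₛ (scal c f) h ≈ scal c (compₛ f h)
comp-scal c f h = mk≈ λ n → trans (sumTo-cong n (λ k _ → ZP.*-assoc c (f k) (powₛ h k n))) (sumTo-*l n c _)

comp-neg : ∀ f h → compₛ (negₛ f) h ≈ negₛ (compₛ f h)
comp-neg f h = mk≈ λ n → trans (sumTo-cong n (λ k _ → sym (ZP.neg-distribˡ-* (f k) (powₛ h k n)))) (sumTo-neg n _)

comp-one : ∀ h → compₛ oneₛ h ≈ oneₛ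
comp-one h = mk≈ λ n → trans (sumTo-ext 0 n _ (higherTerms n) z≤n) (ZP.*-identityˡ (oneₛ n))
  where
  higherTerms : ∀ n k → 0 < k → oneₛ k * powₛ h k n ≡ 0ℤ
  higherTerms n (suc k) _ = ZP.*-zeroˡ (powₛ h (suc k) n)

-- Truncating the defining sum of (g ∘ h)_n at any N ≥ n gives the same value,
-- because h^k has order ≥ k.
comp-truncate : ∀ g h → h 0 ≡ 0ℤ → ∀ n N → n ≤ N → compₛ g h n ≡ sumTo N (λ k → g k * powₛ h k n)
comp-truncate g h h0 n N n≤N = sym (sumTo-ext n N _ higherTerms n≤N)
  where
  higherTerms : ∀ k → n < k → g k * powₛ h k n ≡ 0ℤ
  higherTerms k n<k = trans (cong (g k *_) (order-pow h h0 k n n<k)) (ZP.*-zeroʳ (g k))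

mul-comp : ∀ g h → h 0 ≡ 0ℤ → ∀ m →
  (h *ₛ compₛ g h) (suc m) ≡ sumTo m (λ k → g k * powₛ h (suc k) (suc m))
mul-comp g h h0 m = begin
  (h *ₛ compₛ g h) n                                         ≡⟨ mul≡conv h (compₛ g h) n ⟩
  conv n (λ i j → h i * compₛ g h j)                         ≡⟨ conv-cong n truncate ⟩
  conv n (λ i j → h i * sumTo n (λ k → g k * powₛ h k j))    ≡⟨ conv-cong n (λ i j _ → distribute i j) ⟩
  conv n (λ i j → sumTo n (λ k → g k * (h i * powₛ h k j)))  ≡⟨ conv-sumTo n n (λ k i j → g k * (h i * powₛ h k j)) ⟩
  sumTo n (λ k → conv n (λ i j → g k * (h i * powₛ h k j)))  ≡⟨ sumTo-cong n (λ k _ → factor k) ⟩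
  sumTo n (λ k → g k * powₛ h (suc k) n)                     ≡⟨ sumTo-ext m n _ topTerm (NP.n≤1+n m) ⟩
  sumTo m (λ k → g k * powₛ h (suc k) n)                     ∎
  where
  open ≡-Reasoning
  n = suc m
  truncate : ∀ i j → i N.+ j ≡ n → h i * compₛ g h j ≡ h i * sumTo n (λ k → g k * powₛ h k j)
  truncate i j i+j≡n = cong (h i *_) (comp-truncate g h h0 j n (subst (j ≤_) i+j≡n (NP.m≤n+m j i)))
  distribute : ∀ i j → h i * sumTo n (λ k → g k * powₛ h k j) ≡ sumTo n (λ k → g k * (h i * powₛ h k j))
  distribute i j = trans (sym (sumTo-*l n (h i) (λ k → g k * powₛ h k j))) (sumTo-cong n (λ k _ → exchange (h i) (g k) (powₛ h k j)))
    where
    exchange : ∀ (a b c : ℤ) → a * (b * c) ≡ b * (a * c)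
    exchange = solve-∀
  factor : ∀ k → conv n (λ i j → g k * (h i * powₛ h k j)) ≡ g k * powₛ h (suc k) n
  factor k = trans (conv-*l n (g k) (λ i j → h i * powₛ h k j)) (cong (g k *_) (sym (mul≡conv h (powₛ h k) n)))
  topTerm : ∀ k → m < k → g k * powₛ h (suc k) n ≡ 0ℤ
  topTerm k m<k = trans (cong (g k *_) (order-pow h h0 (suc k) n (s≤s m<k))) (ZP.*-zeroʳ (g k))

comp-rec : ∀ f h → h 0 ≡ 0ℤ → compₛ f h ≈ (scal (f 0) oneₛ +ₛ (h *ₛ compₛ (shift f) h))
comp-rec f h h0 = mk≈ coefficient
  where
  coefficient : ∀ n → compₛ f h n ≡ (scal (f 0) oneₛ +ₛ (h *ₛ compₛ (shift f) h)) n
  coefficient zero    rewrite h0 = sym (ZP.+-identityʳ _)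
  coefficient (suc m) = trans (sumTo-shift m _) (cong (f 0 * 0ℤ +_) (sym (mul-comp (shift f) h h0 m)))

-- Composition with h is multiplicative: both sides, as functions of f,
-- satisfy the same shift recursion.
comp-mul : ∀ h → h 0 ≡ 0ℤ → ∀ f g → compₛ (f *ₛ g) h ≈ (compₛ f h *ₛ compₛ g h)
comp-mul h h0 f g = shift-recursion-unique h h0 base lhs rhs lhs-rec rhs-rec f
  where
  open ≈-Reasoning
  base lhs rhs : Series → Series
  base f = scal (f 0) (compₛ g h)
  lhs  f = compₛ (f *ₛ g) h
  rhs  f = compₛ f h *ₛ compₛ g h
  regroup : ∀ (a b o X Y : ℤ) → a * b * o + (a * X + Y) ≡ a * (b * o + X) + Y
  regroup = solve-∀
  lhs-rec : ∀ f → lhs f ≈ (base f +ₛ (h *ₛ lhs (shift f)))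
  lhs-rec f = begin
    compₛ (f *ₛ g) h
      ≈⟨ comp-rec (f *ₛ g) h h0 ⟩
    (c₀ +ₛ (h *ₛ compₛ (shift (f *ₛ g)) h))
      ≈⟨ +-congˡ c₀ (*-congˡ h (≈-trans (comp-cong₁ h (shift-* f g)) (comp-+ (scal (f 0) (shift g)) (shift f *ₛ g) h))) ⟩
    (c₀ +ₛ (h *ₛ (compₛ (scal (f 0) (shift g)) h +ₛ lhs (shift f))))
      ≈⟨ +-congˡ c₀ (≈-trans (*-distribˡ h (compₛ (scal (f 0) (shift g)) h) (lhs (shift f))) (+-congʳ tail pull-scalar)) ⟩
    (c₀ +ₛ (scal (f 0) (h *ₛ compₛ (shift g) h) +ₛ tail))
      ≈⟨ mk≈ (λ n → regroup (f 0) (g 0) (oneₛ n) ((h *ₛ compₛ (shift g) h) n) (tail n)) ⟩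
    (scal (f 0) (scal (g 0) oneₛ +ₛ (h *ₛ compₛ (shift g) h)) +ₛ tail)
      ≈⟨ +-congʳ tail (scal-cong (f 0) (comp-rec g h h0)) ⟨
    (base f +ₛ tail)
      ∎
    where
    c₀ tail : Series
    c₀   = scal (f 0 * g 0) oneₛ
    tail = h *ₛ lhs (shift f)
    pull-scalar : (h *ₛ compₛ (scal (f 0) (shift g)) h) ≈ scal (f 0) (h *ₛ compₛ (shift g) h)
    pull-scalar = ≈-trans (*-congˡ h (comp-scal (f 0) (shift g) h)) (*-scal (f 0) h (compₛ (shift g) h))
  rhs-rec : ∀ f → rhs f ≈ (base f +ₛ (h *ₛ rhs (shift f)))
  rhs-rec f = begin
    (compₛ f h *ₛ compₛ g h)
      ≈⟨ *-congʳ (compₛ g h) (comp-rec f h h0) ⟩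
    ((scal (f 0) oneₛ +ₛ (h *ₛ compₛ (shift f) h)) *ₛ compₛ g h)
      ≈⟨ *-distribʳ (scal (f 0) oneₛ) (h *ₛ compₛ (shift f) h) (compₛ g h) ⟩
    ((scal (f 0) oneₛ *ₛ compₛ g h) +ₛ ((h *ₛ compₛ (shift f) h) *ₛ compₛ g h))
      ≈⟨ +-cong (≈-trans (scal-* (f 0) oneₛ (compₛ g h)) (scal-cong (f 0) (one-* (compₛ g h))))
                (*-assoc h (compₛ (shift f) h) (compₛ g h)) ⟩
    (base f +ₛ (h *ₛ rhs (shift f)))
      ∎

comp-X : ∀ h → h 0 ≡ 0ℤ → compₛ Xₛ h ≈ h
comp-X h h0 = begin
  compₛ Xₛ h                                      ≈⟨ comp-rec Xₛ h h0 ⟩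
  (scal 0ℤ oneₛ +ₛ (h *ₛ compₛ (shift Xₛ) h))    ≈⟨ +-cong (mk≈ λ n → ZP.*-zeroˡ (oneₛ n))
                                                              (*-congˡ h (≈-trans (comp-cong₁ h shiftX) (comp-one h))) ⟩
  (zeroₛ +ₛ (h *ₛ oneₛ))                          ≈⟨ mk≈ (λ n → ZP.+-identityˡ ((h *ₛ oneₛ) n)) ⟩
  (h *ₛ oneₛ)                                     ≈⟨ *-one h ⟩
  h                                               ∎
  where
  open ≈-Reasoning
  shiftX : shift Xₛ ≈ oneₛ
  shiftX = mk≈ λ { zero → refl ; (suc n) → refl }

ones : Series
ones _ = 1ℤ

inv1p-geometric : ∀ y → inv1p y ≈ compₛ ones (negₛ y)
inv1p-geometric y = mk≈ λ n → sumTo-cong n (λ k _ → sym (ZP.*-identityˡ (powₛ (negₛ y) k n)))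

inv1p-rec : ∀ y → y 0 ≡ 0ℤ → inv1p y ≈ (oneₛ +ₛ (negₛ y *ₛ inv1p y))
inv1p-rec y y0 = begin
  inv1p y                                               ≈⟨ inv1p-geometric y ⟩
  compₛ ones (negₛ y)                                   ≈⟨ comp-rec ones (negₛ y) (cong -_ y0) ⟩
  (scal 1ℤ oneₛ +ₛ (negₛ y *ₛ compₛ ones (negₛ y)))    ≈⟨ +-cong (mk≈ λ n → ZP.*-identityˡ (oneₛ n))
                                                                   (*-congˡ (negₛ y) (≈-sym (inv1p-geometric y))) ⟩
  (oneₛ +ₛ (negₛ y *ₛ inv1p y))                         ∎
  where open ≈-Reasoning

inv1p-unique : ∀ y → y 0 ≡ 0ℤ → ∀ {J} → J ≈ (oneₛ +ₛ (negₛ y *ₛ J)) → J ≈ inv1p y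
inv1p-unique y y0 hJ = fixpoint-unique₁ (λ J → oneₛ +ₛ (negₛ y *ₛ J)) contractive hJ (inv1p-rec y y0)
  where
  contractive : ∀ n f g → (∀ m → m < n → f m ≡ g m) → (oneₛ +ₛ (negₛ y *ₛ f)) n ≡ (oneₛ +ₛ (negₛ y *ₛ g)) n
  contractive n f g agree = cong (oneₛ n +_) (mul-local-strict (negₛ y) n (cong -_ y0) agree)

inv1p-cong : ∀ {y y′} → y ≈ y′ → inv1p y ≈ inv1p y′
inv1p-cong e = mk≈ λ n → sumTo-cong n (λ k _ → at (pow-cong (neg-cong e) k) n)

-- Composition commutes with 1/(1+·), by uniqueness of the solution of J = 1 − y·J.
comp-inv1p : ∀ h y → h 0 ≡ 0ℤ → y 0 ≡ 0ℤ → compₛ (inv1p y) h ≈ inv1p (compₛ y h)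
comp-inv1p h y h0 y0 = inv1p-unique (compₛ y h) (comp0 y h y0) (begin
  compₛ (inv1p y) h                                          ≈⟨ comp-cong₁ h (inv1p-rec y y0) ⟩
  compₛ (oneₛ +ₛ (negₛ y *ₛ inv1p y)) h                      ≈⟨ comp-+ oneₛ (negₛ y *ₛ inv1p y) h ⟩
  (compₛ oneₛ h +ₛ compₛ (negₛ y *ₛ inv1p y) h)              ≈⟨ +-cong (comp-one h) (comp-mul h h0 (negₛ y) (inv1p y)) ⟩
  (oneₛ +ₛ (compₛ (negₛ y) h *ₛ compₛ (inv1p y) h))          ≈⟨ +-congˡ oneₛ (*-congʳ (compₛ (inv1p y) h) (comp-neg y h)) ⟩
  (oneₛ +ₛ (negₛ (compₛ y h) *ₛ compₛ (inv1p y) h))          ∎)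
  where open ≈-Reasoning

Aop-cong : ∀ {y y′} → y ≈ y′ → Aop y ≈ Aop y′
Aop-cong e = *-cong e (inv1p-cong e)

Bop-cong : ∀ {y y′} → y ≈ y′ → Bop y ≈ Bop y′
Bop-cong e = *-cong e (inv1p-cong (*-cong e e))

comp-Aop : ∀ h y → h 0 ≡ 0ℤ → y 0 ≡ 0ℤ → compₛ (Aop y) h ≈ Aop (compₛ y h)
comp-Aop h y h0 y0 = ≈-trans (comp-mul h h0 y (inv1p y)) (*-congˡ (compₛ y h) (comp-inv1p h y h0 y0))

comp-Bop : ∀ h y → h 0 ≡ 0ℤ → y 0 ≡ 0ℤ → compₛ (Bop y) h ≈ Bop (compₛ y h)
comp-Bop h y h0 y0 = ≈-trans (comp-mul h h0 y (inv1p (y *ₛ y)))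
  (*-congˡ (compₛ y h) (≈-trans (comp-inv1p h (y *ₛ y) h0 (mul0 y y y0)) (inv1p-cong (comp-mul h h0 y y))))

Bj0 : ∀ j → Bj j 0 ≡ 0ℤ
Bj0 zero    = refl
Bj0 (suc j) = mul0 (Bj j) (inv1p (Bj j *ₛ Bj j)) (Bj0 j)

Aj0 : ∀ j → Aj j 0 ≡ 0ℤ
Aj0 j = mul0 (Bj j) (inv1p (Bj j)) (Bj0 j)

Bj-step : ∀ j → compₛ (Bj j) Bₛ ≈ Bj (suc j)
Bj-step zero    = comp-X Bₛ (Bj0 1)
Bj-step (suc j) = ≈-trans (comp-Bop Bₛ (Bj j) (Bj0 1) (Bj0 j)) (Bop-cong (Bj-step j))

Aj-step : ∀ j → compₛ (Aj j) Bₛ ≈ Aj (suc j)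
Aj-step j = ≈-trans (comp-Aop Bₛ (Bj j) (Bj0 1) (Bj0 j)) (Aop-cong (Bj-step j))

prodA⁺ : ℕ → Series
prodA⁺ zero    = Aj 1
prodA⁺ (suc n) = prodA⁺ n *ₛ Aj (suc (suc n))

-- (∏_{j≤n} A_j) ∘ B = ∏_{j=1}^{n+1} A_j, as composition with B is multiplicative.
prodA-step : ∀ n → compₛ (prodA n) Bₛ ≈ prodA⁺ n
prodA-step zero    = Aj-step 0
prodA-step (suc n) = ≈-trans (comp-mul Bₛ (Bj0 1) (prodA n) (Aj (suc n))) (*-cong (prodA-step n) (Aj-step (suc n)))

prodA-unshift : ∀ n → (Aj 0 *ₛ prodA⁺ n) ≈ prodA (suc n)
prodA-unshift zero    = ≈-refl
prodA-unshift (suc n) = ≈-trans (≈-sym (*-assoc (Aj 0) (prodA⁺ n) (Aj (suc (suc n))))) (*-congʳ (Aj (suc (suc n))) (prodA-unshift n))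

prodA-order : ∀ n → OrderAtLeast (suc n) (prodA n)
prodA-order zero    = order-one (Aj 0) (Aj0 0)
prodA-order (suc n) = subst (λ a → OrderAtLeast a (prodA (suc n))) (NP.+-comm (suc n) 1)
  (order-* (suc n) 1 (prodA n) (Aj (suc n)) (prodA-order n) (order-one (Aj (suc n)) (Aj0 (suc n))))

Σₛ : ℕ → (ℕ → Series) → Series
Σₛ N F m = sumTo N (λ n → F n m)

Σₛ-cong : ∀ N {F G : ℕ → Series} → (∀ n → F n ≈ G n) → Σₛ N F ≈ Σₛ N G
Σₛ-cong N e = mk≈ λ m → sumTo-cong N (λ n _ → at (e n) m)

comp-Σₛ : ∀ N F h → compₛ (Σₛ N F) h ≈ Σₛ N (λ n → compₛ (F n) h)
comp-Σₛ zero    F h = ≈-refl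
comp-Σₛ (suc N) F h = ≈-trans (comp-+ (Σₛ N F) (F (suc N)) h) (+-congʳ (compₛ (F (suc N)) h) (comp-Σₛ N F h))

*-Σₛ : ∀ N f F → (f *ₛ Σₛ N F) ≈ Σₛ N (λ n → f *ₛ F n)
*-Σₛ zero    f F = ≈-refl
*-Σₛ (suc N) f F = ≈-trans (*-distribˡ f (Σₛ N F) (F (suc N))) (+-congʳ (f *ₛ F (suc N)) (*-Σₛ N f F))

partialSum-rec : ∀ N → partialSum (suc N) ≈ (Aₛ *ₛ compₛ (oneₛ +ₛ partialSum N) Bₛ)
partialSum-rec N = begin
  partialSum (suc N)                          ≈⟨ mk≈ (λ m → sumTo-shift N (λ n → prodA n m)) ⟩
  (Aₛ +ₛ Σₛ N (λ n → prodA (suc n)))          ≈⟨ +-cong (*-one Aₛ) (≈-trans (*-Σₛ N Aₛ prodA⁺) (Σₛ-cong N prodA-unshift)) ⟨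
  ((Aₛ *ₛ oneₛ) +ₛ (Aₛ *ₛ Σₛ N prodA⁺))       ≈⟨ *-distribˡ Aₛ oneₛ (Σₛ N prodA⁺) ⟨
  (Aₛ *ₛ (oneₛ +ₛ Σₛ N prodA⁺))               ≈⟨ *-congˡ Aₛ composeTerms ⟨
  (Aₛ *ₛ compₛ (oneₛ +ₛ partialSum N) Bₛ)     ∎
  where
  open ≈-Reasoning
  composeTerms : compₛ (oneₛ +ₛ partialSum N) Bₛ ≈ (oneₛ +ₛ Σₛ N prodA⁺)
  composeTerms = ≈-trans (comp-+ oneₛ (partialSum N) Bₛ)
                         (+-cong (comp-one Bₛ) (≈-trans (comp-Σₛ N prodA Bₛ) (Σₛ-cong N prodA-step)))

limitSeries : Series
limitSeries m = partialSum m m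

partialSum-stable : ∀ m N → m ≤ N → partialSum N m ≡ limitSeries m
partialSum-stable m N = sumTo-ext m N _ (λ n m<n → prodA-order n m (NP.m<n⇒m<1+n m<n))

partialSum-converges : ConvergesTo partialSum limitSeries
partialSum-converges m = m , λ N m≤N → partialSum-stable m N m≤N

-- Passing to the limit in partialSum-rec: coefficient m of both sides only
-- involves P_m in degrees ≤ m.
limit-solves : SolvesFE (oneₛ +ₛ limitSeries)
limit-solves m = cong (oneₛ m +_) (begin
  limitSeries m                                        ≡⟨ partialSum-stable m (suc m) (NP.n≤1+n m) ⟨
  partialSum (suc m) m                                 ≡⟨ at (partialSum-rec m) m ⟩
  (Aₛ *ₛ compₛ (oneₛ +ₛ partialSum m) Bₛ) m           ≡⟨ mul-localʳ Aₛ m (λ j j≤m → comp-local Bₛ j (λ k k≤j →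
                                                            cong (oneₛ k +_) (partialSum-stable k m (NP.≤-trans k≤j j≤m)))) ⟩
  (Aₛ *ₛ compₛ (oneₛ +ₛ limitSeries) Bₛ) m            ∎)
  where open ≡-Reasoning

-- Since A₀ = 0, the map T ↦ 1 + A·(T ∘ B) is contractive; so it has one fixed point.
solution-unique : ∀ {T T′} → SolvesFE T → SolvesFE T′ → T ≈ T′
solution-unique hT hT′ = fixpoint-unique₁ (λ T → oneₛ +ₛ (Aₛ *ₛ compₛ T Bₛ)) contractive (mk≈ hT) (mk≈ hT′)
  where
  contractive : ∀ n f g → (∀ m → m < n → f m ≡ g m) →
    (oneₛ +ₛ (Aₛ *ₛ compₛ f Bₛ)) n ≡ (oneₛ +ₛ (Aₛ *ₛ compₛ g Bₛ)) n
  contractive n f g agree = cong (oneₛ n +_) (mul-local-strict Aₛ n (Aj0 0)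
    (λ j j<n → comp-local Bₛ j (λ k k≤j → agree k (NP.≤-<-trans k≤j j<n))))

theorem2p4 : Σ Series (λ U → ConvergesTo partialSum U
    × SolvesFE (oneₛ +ₛ U)
    × ((T : Series) → SolvesFE T → T ≈ₛ (oneₛ +ₛ U)))
theorem2p4 =
  limitSeries , partialSum-converges , limit-solves , λ T hT → at (solution-unique hT limit-solves)
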